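{- For every stoup $S$ and contexts $\Gamma, \Delta$ and formula $C$, there is an operation $\otimes\mathrm L^{*-1}$ sending cut-free derivations of $\llbracket S \mid \Gamma \rrbracket \mid \Delta \vdash C$ to cut-free derivations of $S \mid \Gamma, \Delta \vdash C$, which is compatible with $\circeq$ and satisfies $\otimes\mathrm L^{*-1}(\otimes\mathrm L^{*} f) = f$ for every cut-free derivation $f$ of $S \mid \Gamma, \Delta \vdash C$ and $\otimes\mathrm L^{*}(\otimes\mathrm L^{*-1} f) \circeq f$ for every cut-free derivation $f$ of $\llbracket S \mid \Gamma \rrbracket \mid \Delta \vdash C$.
   Context: Fix a set $\mathrm{Var}$ of atoms. Formulae: atoms $X \in \mathrm{Var}$, $\mathsf{I}$, and $A \otimes B$ for formulae $A, B$. A context is a finite list of formulae; a stoup $S$ is either empty (written $-$) or a single formula. Interpretation: $\llbracket - \rrbracket = \mathsf I$, $\llbracket A \rrbracket = A$, and $\llbracket S \mid A_1,\dots,A_n \rrbracket = (\cdots(\llbracket S \rrbracket \otimes A_1)\cdots) \otimes A_n$ (a formula, used as a stoup). Cut-free skew monoidal sequent calculus: sequents $S \mid \Gamma \vdash C$ derived by (ax) $A \mid\ \vdash A$; (pass) from $A \mid \Gamma \vdash C$ infer $- \mid A, \Gamma \vdash C$; ($\mathsf I$L) from $- \mid \Gamma \vdash C$ infer $\mathsf I \mid \Gamma \vdash C$; ($\mathsf I$R) $- \mid\ \vdash \mathsf I$; ($\otimes$L) from $A \mid B, \Gamma \vdash C$ infer $A \otimes B \mid \Gamma \vdash C$; ($\otimes$R)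 from $S \mid \Gamma \vdash A$ and $- \mid \Delta \vdash B$ infer $S \mid \Gamma, \Delta \vdash A \otimes B$. The operation $\otimes\mathrm L^{*}$ takes a cut-free derivation of $S \mid A_1,\dots,A_n, \Delta \vdash C$ to one of $\llbracket S \mid A_1,\dots,A_n \rrbracket \mid \Delta \vdash C$ by iterated application of $\mathsf I$L and $\otimes$L: if $S = -$, first apply $\mathsf I$L to get stoup $\mathsf I$; then, with stoup $B$, apply $\otimes$L successively to obtain stoups $B \otimes A_1$, $(B \otimes A_1) \otimes A_2$, ..., consuming $A_1, \dots, A_n$ from the context. The relation $\circeq$ is the least congruence on cut-free derivations (w.r.t. all rules) containing: $\mathrm{ax}_{\mathsf I} \circeq \mathsf{I}\mathrm{L}(\mathsf I\mathrm R)$; $\mathrm{ax}_{A \otimes B} \circeq \otimes\mathrm L(\otimes\mathrm R(\mathrm{ax}_A, \mathrm{pass}(\mathrm{ax}_B)))$; $\otimes\mathrm R(\mathrm{pass}\, f, g) \circeq \mathrm{pass}(\otimes\mathrm R(f, g))$; $\otimes\mathrm R(\mathsf I\mathrm L\, f, g) \circeq \mathsf I\mathrm L(\otimes\mathrm R(f, g))$; $\otimes\mathrm R(\otimes\mathrm L\, f, g) \circeq \otimes\mathrm L(\otimes\mathrm R(f, g))$. Compatibility with $\circeq$ means $f \circeq g$ implies $\otimes\mathrm L^{*-1} f \circeq \otimes\mathrm L^{*-1} g$. -}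

module Defs where

open import Data.List using (List; []; _∷_; _++_)
open import Relation.Binary.PropositionalEquality using (_≡_)

data Fma (Var : Set) : Set where
  ` : Var → Fma Var
  I : Fma Var
  _⊗_ : Fma Var → Fma Var → Fma Var

infixl 25 _⊗_

data Stp (Var : Set) : Set where
  ─ : Stp Var
  just : Fma Var → Stp Var

Cxt : Set → Set
Cxt Var = List (Fma Var)

⟦_⟧ : {Var : Set} → Stp Var → Fma Var
⟦ ─ ⟧ = I
⟦ just A ⟧ = A

⟦_∣_⟧ : {Var : Set} → Stp Var → Cxt Var → Fma Var
⟦ S ∣ Γ ⟧ = go ⟦ S ⟧ Γ
  where
  go : _ → _ → _
  go B [] = B
  go B (A ∷ Γ) = go (B ⊗ A) Γ

-- Cut-free skew monoidal sequent calculus: S ∣ Γ ⊢ C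
infix 15 _∣_⊢_
data _∣_⊢_ {Var : Set} : Stp Var → Cxt Var → Fma Var → Set where
  ax : {A : Fma Var} → just A ∣ [] ⊢ A
  pass : {Γ : Cxt Var} {A C : Fma Var} → just A ∣ Γ ⊢ C → ─ ∣ A ∷ Γ ⊢ C
  IL : {Γ : Cxt Var} {C : Fma Var} → ─ ∣ Γ ⊢ C → just I ∣ Γ ⊢ C
  IR : ─ ∣ [] ⊢ I
  ⊗L : {Γ : Cxt Var} {A B C : Fma Var} → just A ∣ B ∷ Γ ⊢ C → just (A ⊗ B) ∣ Γ ⊢ C
  ⊗R : {S : Stp Var} {Γ Δ : Cxt Var} {A B : Fma Var} →
       S ∣ Γ ⊢ A → ─ ∣ Δ ⊢ B → S ∣ Γ ++ Δ ⊢ A ⊗ B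

⊗L⋆-from : {Var : Set} (B : Fma Var) (Γ Δ : Cxt Var) {C : Fma Var} →
           just B ∣ Γ ++ Δ ⊢ C → just (⟦_∣_⟧ (just B) Γ) ∣ Δ ⊢ C
⊗L⋆-from B [] Δ f = f
⊗L⋆-from B (A ∷ Γ) Δ f = ⊗L⋆-from (B ⊗ A) Γ Δ (⊗L f)

⊗L⋆ : {Var : Set} (S : Stp Var) (Γ Δ : Cxt Var) {C : Fma Var} →
      S ∣ Γ ++ Δ ⊢ C → just ⟦ S ∣ Γ ⟧ ∣ Δ ⊢ C
⊗L⋆ ─ Γ Δ f = ⊗L⋆-from I Γ Δ (IL f)
⊗L⋆ (just B) Γ Δ f = ⊗L⋆-from B Γ Δ f

infix 10 _≗_
data _≗_ {Var : Set} : {S : Stp Var} {Γ : Cxt Var} {C : Fma Var} →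
         S ∣ Γ ⊢ C → S ∣ Γ ⊢ C → Set where
  refl≗ : ∀ {S Γ C} {f : S ∣ Γ ⊢ C} → f ≗ f
  ~_ : ∀ {S Γ C} {f g : S ∣ Γ ⊢ C} → f ≗ g → g ≗ f
  _∙_ : ∀ {S Γ C} {f g h : S ∣ Γ ⊢ C} → f ≗ g → g ≗ h → f ≗ h
  pass : ∀ {Γ A C} {f g : just A ∣ Γ ⊢ C} → f ≗ g → pass f ≗ pass g
  IL : ∀ {Γ C} {f g : ─ ∣ Γ ⊢ C} → f ≗ g → IL f ≗ IL g
  ⊗L : ∀ {Γ A B C} {f g : just A ∣ B ∷ Γ ⊢ C} → f ≗ g → ⊗L f ≗ ⊗L g
  ⊗R : ∀ {S Γ Δ A B} {f g : S ∣ Γ ⊢ A} {f' g' : ─ ∣ Δ ⊢ B} →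
       f ≗ g → f' ≗ g' → ⊗R f f' ≗ ⊗R g g'
  axI : ax ≗ IL IR
  ax⊗ : ∀ {A B} → ax {A = A ⊗ B} ≗ ⊗L (⊗R ax (pass ax))
  ⊗Rpass : ∀ {Γ Δ A A' B} {f : just A' ∣ Γ ⊢ A} {g : ─ ∣ Δ ⊢ B} →
           ⊗R (pass f) g ≗ pass (⊗R f g)
  ⊗RIL : ∀ {Γ Δ A B} {f : ─ ∣ Γ ⊢ A} {g : ─ ∣ Δ ⊢ B} →
         ⊗R (IL f) g ≗ IL (⊗R f g)
  ⊗R⊗L : ∀ {Γ Δ A A' B' B} {f : just A' ∣ B' ∷ Γ ⊢ A} {g : ─ ∣ Δ ⊢ B} →
         ⊗R (⊗L f) g ≗ ⊗L (⊗R f g)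

-- The left rules ⊗L and IL are invertible.  Their inverses push through
-- ⊗R (besides ax, the only other rule with a formula in the stoup)
-- and η-expand an axiom; the generating equations of ≗ are exactly what
-- makes each inverse a right inverse up to ≗, while it is a left inverse
-- on the nose.  Iterating along Γ gives the inverse of ⊗L⋆.
module Submission where

open import Defs
open import Data.List using ([]; _∷_; _++_)
open import Data.Product using (Σ; _×_; _,_)
open import Relation.Binary.PropositionalEquality using (_≡_; refl; cong)

module _ {Var : Set} where

  ⊗L⁻¹ : {Γ : Cxt Var} {A B C : Fma Var} →
         just (A ⊗ B) ∣ Γ ⊢ C → just A ∣ B ∷ Γ ⊢ C
  ⊗L⁻¹ ax = ⊗R ax (pass ax)
  ⊗L⁻¹ (⊗L f) = f
  ⊗L⁻¹ (⊗R f g) = ⊗R (⊗L⁻¹ f) g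

  IL⁻¹ : {Γ : Cxt Var} {C : Fma Var} → just I ∣ Γ ⊢ C → ─ ∣ Γ ⊢ C
  IL⁻¹ ax = IR
  IL⁻¹ (IL f) = f
  IL⁻¹ (⊗R f g) = ⊗R (IL⁻¹ f) g

  ⊗L⁻¹-cong : {Γ : Cxt Var} {A B C : Fma Var} {f g : just (A ⊗ B) ∣ Γ ⊢ C} →
              f ≗ g → ⊗L⁻¹ f ≗ ⊗L⁻¹ g
  ⊗L⁻¹-cong refl≗ = refl≗
  ⊗L⁻¹-cong (~ p) = ~ ⊗L⁻¹-cong p
  ⊗L⁻¹-cong (p ∙ q) = ⊗L⁻¹-cong p ∙ ⊗L⁻¹-cong q
  ⊗L⁻¹-cong (⊗L p) = p
  ⊗L⁻¹-cong (⊗R p q) = ⊗R (⊗L⁻¹-cong p) q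
  ⊗L⁻¹-cong ax⊗ = refl≗
  ⊗L⁻¹-cong ⊗R⊗L = refl≗

  IL⁻¹-cong : {Γ : Cxt Var} {C : Fma Var} {f g : just I ∣ Γ ⊢ C} →
              f ≗ g → IL⁻¹ f ≗ IL⁻¹ g
  IL⁻¹-cong refl≗ = refl≗
  IL⁻¹-cong (~ p) = ~ IL⁻¹-cong p
  IL⁻¹-cong (p ∙ q) = IL⁻¹-cong p ∙ IL⁻¹-cong q
  IL⁻¹-cong (IL p) = p
  IL⁻¹-cong (⊗R p q) = ⊗R (IL⁻¹-cong p) q
  IL⁻¹-cong axI = refl≗
  IL⁻¹-cong ⊗RIL = refl≗

  ⊗L∘⊗L⁻¹ : {Γ : Cxt Var} {A B C : Fma Var} (f : just (A ⊗ B) ∣ Γ ⊢ C) →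
            ⊗L (⊗L⁻¹ f) ≗ f
  ⊗L∘⊗L⁻¹ ax = ~ ax⊗
  ⊗L∘⊗L⁻¹ (⊗L f) = refl≗
  ⊗L∘⊗L⁻¹ (⊗R f g) = (~ ⊗R⊗L) ∙ ⊗R (⊗L∘⊗L⁻¹ f) refl≗

  IL∘IL⁻¹ : {Γ : Cxt Var} {C : Fma Var} (f : just I ∣ Γ ⊢ C) → IL (IL⁻¹ f) ≗ f
  IL∘IL⁻¹ ax = ~ axI
  IL∘IL⁻¹ (IL f) = refl≗
  IL∘IL⁻¹ (⊗R f g) = (~ ⊗RIL) ∙ ⊗R (IL∘IL⁻¹ f) refl≗

  ⊗L⋆-from-cong : (B : Fma Var) (Γ Δ : Cxt Var) {C : Fma Var}
                  {f g : just B ∣ Γ ++ Δ ⊢ C} →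
                  f ≗ g → ⊗L⋆-from B Γ Δ f ≗ ⊗L⋆-from B Γ Δ g
  ⊗L⋆-from-cong B [] Δ p = p
  ⊗L⋆-from-cong B (A ∷ Γ) Δ p = ⊗L⋆-from-cong (B ⊗ A) Γ Δ (⊗L p)

  ⊗L⋆-from⁻¹ : (B : Fma Var) (Γ Δ : Cxt Var) {C : Fma Var} →
               just ⟦ just B ∣ Γ ⟧ ∣ Δ ⊢ C → just B ∣ Γ ++ Δ ⊢ C
  ⊗L⋆-from⁻¹ B [] Δ f = f
  ⊗L⋆-from⁻¹ B (A ∷ Γ) Δ f = ⊗L⁻¹ (⊗L⋆-from⁻¹ (B ⊗ A) Γ Δ f)

  ⊗L⋆-from⁻¹-cong : (B : Fma Var) (Γ Δ : Cxt Var) {C : Fma Var}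
                    {f g : just ⟦ just B ∣ Γ ⟧ ∣ Δ ⊢ C} →
                    f ≗ g → ⊗L⋆-from⁻¹ B Γ Δ f ≗ ⊗L⋆-from⁻¹ B Γ Δ g
  ⊗L⋆-from⁻¹-cong B [] Δ p = p
  ⊗L⋆-from⁻¹-cong B (A ∷ Γ) Δ p = ⊗L⁻¹-cong (⊗L⋆-from⁻¹-cong (B ⊗ A) Γ Δ p)

  ⊗L⋆-from⁻¹∘⊗L⋆-from : (B : Fma Var) (Γ Δ : Cxt Var) {C : Fma Var}
                        (f : just B ∣ Γ ++ Δ ⊢ C) →
                        ⊗L⋆-from⁻¹ B Γ Δ (⊗L⋆-from B Γ Δ f) ≡ f
  ⊗L⋆-from⁻¹∘⊗L⋆-from B [] Δ f = refl
  ⊗L⋆-from⁻¹∘⊗L⋆-from B (A ∷ Γ) Δ f =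
    cong ⊗L⁻¹ (⊗L⋆-from⁻¹∘⊗L⋆-from (B ⊗ A) Γ Δ (⊗L f))

  ⊗L⋆-from∘⊗L⋆-from⁻¹ : (B : Fma Var) (Γ Δ : Cxt Var) {C : Fma Var}
                        (f : just ⟦ just B ∣ Γ ⟧ ∣ Δ ⊢ C) →
                        ⊗L⋆-from B Γ Δ (⊗L⋆-from⁻¹ B Γ Δ f) ≗ f
  ⊗L⋆-from∘⊗L⋆-from⁻¹ B [] Δ f = refl≗
  ⊗L⋆-from∘⊗L⋆-from⁻¹ B (A ∷ Γ) Δ f =
    ⊗L⋆-from-cong (B ⊗ A) Γ Δ (⊗L∘⊗L⁻¹ (⊗L⋆-from⁻¹ (B ⊗ A) Γ Δ f))
    ∙ ⊗L⋆-from∘⊗L⋆-from⁻¹ (B ⊗ A) Γ Δ f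

  ⊗L⋆⁻¹ : (S : Stp Var) (Γ Δ : Cxt Var) {C : Fma Var} →
          just ⟦ S ∣ Γ ⟧ ∣ Δ ⊢ C → S ∣ Γ ++ Δ ⊢ C
  ⊗L⋆⁻¹ ─ Γ Δ f = IL⁻¹ (⊗L⋆-from⁻¹ I Γ Δ f)
  ⊗L⋆⁻¹ (just B) Γ Δ f = ⊗L⋆-from⁻¹ B Γ Δ f

  ⊗L⋆⁻¹-cong : (S : Stp Var) (Γ Δ : Cxt Var) {C : Fma Var}
               {f g : just ⟦ S ∣ Γ ⟧ ∣ Δ ⊢ C} →
               f ≗ g → ⊗L⋆⁻¹ S Γ Δ f ≗ ⊗L⋆⁻¹ S Γ Δ g
  ⊗L⋆⁻¹-cong ─ Γ Δ p = IL⁻¹-cong (⊗L⋆-from⁻¹-cong I Γ Δ p)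
  ⊗L⋆⁻¹-cong (just B) Γ Δ p = ⊗L⋆-from⁻¹-cong B Γ Δ p

  ⊗L⋆⁻¹∘⊗L⋆ : (S : Stp Var) (Γ Δ : Cxt Var) {C : Fma Var} (f : S ∣ Γ ++ Δ ⊢ C) →
              ⊗L⋆⁻¹ S Γ Δ (⊗L⋆ S Γ Δ f) ≡ f
  ⊗L⋆⁻¹∘⊗L⋆ ─ Γ Δ f = cong IL⁻¹ (⊗L⋆-from⁻¹∘⊗L⋆-from I Γ Δ (IL f))
  ⊗L⋆⁻¹∘⊗L⋆ (just B) Γ Δ f = ⊗L⋆-from⁻¹∘⊗L⋆-from B Γ Δ f

  ⊗L⋆∘⊗L⋆⁻¹ : (S : Stp Var) (Γ Δ : Cxt Var) {C : Fma Var}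
              (f : just ⟦ S ∣ Γ ⟧ ∣ Δ ⊢ C) → ⊗L⋆ S Γ Δ (⊗L⋆⁻¹ S Γ Δ f) ≗ f
  ⊗L⋆∘⊗L⋆⁻¹ ─ Γ Δ f =
    ⊗L⋆-from-cong I Γ Δ (IL∘IL⁻¹ (⊗L⋆-from⁻¹ I Γ Δ f))
    ∙ ⊗L⋆-from∘⊗L⋆-from⁻¹ I Γ Δ f
  ⊗L⋆∘⊗L⋆⁻¹ (just B) Γ Δ f = ⊗L⋆-from∘⊗L⋆-from⁻¹ B Γ Δ f

lemma4p7 : {Var : Set} (S : Stp Var) (Γ Δ : Cxt Var) (C : Fma Var) →
    Σ (just ⟦ S ∣ Γ ⟧ ∣ Δ ⊢ C → S ∣ Γ ++ Δ ⊢ C) (λ ⊗L⋆⁻¹ →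
      ((f g : just ⟦ S ∣ Γ ⟧ ∣ Δ ⊢ C) → f ≗ g → ⊗L⋆⁻¹ f ≗ ⊗L⋆⁻¹ g)
      × ((f : S ∣ Γ ++ Δ ⊢ C) → ⊗L⋆⁻¹ (⊗L⋆ S Γ Δ f) ≡ f)
      × ((f : just ⟦ S ∣ Γ ⟧ ∣ Δ ⊢ C) → ⊗L⋆ S Γ Δ (⊗L⋆⁻¹ f) ≗ f))
lemma4p7 S Γ Δ C =
  ⊗L⋆⁻¹ S Γ Δ ,
  (λ f g → ⊗L⋆⁻¹-cong S Γ Δ) ,
  ⊗L⋆⁻¹∘⊗L⋆ S Γ Δ ,
  ⊗L⋆∘⊗L⋆⁻¹ S Γ Δ
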